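{- Let $G$ be a split graph as in the context, and let $C_i = (U_i, V_i, E_i)$ be one of its clusters. Let $I_1 \neq I_2$ be typical independent sets of $G$ with $|I_1| = |I_2|$, $|I_1 \cap U_i| = |I_2 \cap U_i|$ and $I_1 \setminus U_i = I_2 \setminus U_i$. Then $I_1 \rightsquigarrow_2 I_2$.
   Context: For independent sets $I, J$ of a graph $G$, write $I \leftrightarrow_2 J$ if $|I \setminus J| = |J \setminus I| = 1$ and $\mathrm{dist}_G(u,v) \le 2$ where $I \setminus J = \{u\}$, $J \setminus I = \{v\}$; write $I \rightsquigarrow_2 J$ if there is a finite sequence $I = I_0, \dots, I_\ell = J$ ($\ell \ge 0$) of independent sets with $I_j \leftrightarrow_2 I_{j+1}$ for all $j$. Setting: $G$ is a split graph with vertex set partitioned as $V^A \cup U^B$, where $V^A$ is a clique and $U^B$ is an independent set, and every vertex of $U^B$ has a neighbor in $V^A$. Let $V^B \subseteq V^A$ be the set of vertices of $V^A$ having a neighbor in $U^B$, and let $G^B$ be the bipartite graph with parts $V^B$ and $U^B$ whose edges are the edges of $G$ between $V^A$ and $U^B$. A cluster is a connected component of $G^B$, written $(U_C, V_C, E_C)$ with $U_C \subseteq U^B$, $V_C \subseteq V^B$ and edge set $E_C$; in addition, if $V' = V^A \setminus V^B \neq \emptyset$, then $(\emptyset, V', \emptyset)$ is also a cluster. A typical independent set is an independent set $I$ of $G$ with $I \cap V^A = \emptyset$. -}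

module Defs where

open import Data.Nat using (ℕ)
open import Data.Fin using (Fin)
open import Data.Fin.Subset using (Subset; _∈_; _∉_; _∪_; _─_; ⁅_⁆; ⊥)
open import Data.Product using (Σ; ∃; _×_; _,_)
open import Data.Sum using (_⊎_)
open import Relation.Nullary using (¬_)
open import Relation.Binary.PropositionalEquality using (_≡_)
open import Relation.Binary.Construct.Closure.ReflexiveTransitive using (Star)
open import Function.Bundles using (_⇔_)

record Graph (n : ℕ) : Set₁ where
  field
    Adj     : Fin n → Fin n → Set
    sym     : ∀ {x y} → Adj x y → Adj y x
    irrefl  : ∀ {x} → ¬ Adj x x
open Graph public

record IsSplit {n : ℕ} (G : Graph n) (VA : Subset n) : Set where
  field
    clique      : ∀ x y → x ∈ VA → y ∈ VA → ¬ (x ≡ y) → Adj G x y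
    indep       : ∀ x y → x ∉ VA → y ∉ VA → ¬ Adj G x y
    hasNeighbor : ∀ u → u ∉ VA → ∃ λ v → v ∈ VA × Adj G u v

module _ {n : ℕ} (G : Graph n) (VA : Subset n) where

  BEdge : Fin n → Fin n → Set
  BEdge x y = Adj G x y × ((x ∈ VA × y ∉ VA) ⊎ (x ∉ VA × y ∈ VA))

  -- vertices of G^B : V^B ∪ U^B
  InGB : Fin n → Set
  InGB x = ∃ λ y → BEdge x y

  -- (U , V) is a cluster: either the vertex set U ∪ V of a connected component
  -- of G^B (U ⊆ U^B, V ⊆ V^B), or U = ∅ and V = V' = V^A ∖ V^B ≠ ∅.
  data IsCluster (U V : Subset n) : Set where
    component :
      (∀ x → x ∈ U → x ∉ VA) →
      (∀ x → x ∈ V → x ∈ VA) →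
      (∀ x → x ∈ (U ∪ V) → InGB x) →
      (∃ λ x → x ∈ (U ∪ V)) →
      (∀ x y → x ∈ (U ∪ V) → BEdge x y → y ∈ (U ∪ V)) →
      (∀ x y → x ∈ (U ∪ V) → y ∈ (U ∪ V) → Star BEdge x y) →
      IsCluster U V
    extra :
      U ≡ ⊥ →
      (∀ x → (x ∈ V) ⇔ (x ∈ VA × ¬ InGB x)) →
      (∃ λ x → x ∈ V) →
      IsCluster U V

Independent : {n : ℕ} → Graph n → Subset n → Set
Independent G I = ∀ x y → x ∈ I → y ∈ I → ¬ Adj G x y

Typical : {n : ℕ} → Graph n → Subset n → Subset n → Set
Typical G VA I = Independent G I × (∀ x → x ∈ I → x ∉ VA)

Dist≤2 : {n : ℕ} → Graph n → Fin n → Fin n → Set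
Dist≤2 G u v = (u ≡ v) ⊎ Adj G u v ⊎ (∃ λ w → Adj G u w × Adj G w v)

Step₂ : {n : ℕ} → Graph n → Subset n → Subset n → Set
Step₂ G I J = Independent G I × Independent G J ×
  (Σ (Fin _) λ u → Σ (Fin _) λ v →
     (I ─ J ≡ ⁅ u ⁆) × (J ─ I ≡ ⁅ v ⁆) × Dist≤2 G u v)

Reach₂ : {n : ℕ} → Graph n → Subset n → Subset n → Set
Reach₂ G = Star (Step₂ G)

{-# OPTIONS --safe #-}
-- Every subset of U^B is independent, so a typical set is a placement of tokens on U^B and a
-- step ↔₂ slides one token to a free vertex at distance at most 2. Consecutive U^B-vertices of
-- a walk in G^B are at distance 2, so inside a cluster a token can be slid to any free vertex,
-- pushing on the tokens it meets. As I₁ and I₂ agree outside U_i and have the same size, while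
-- they differ some token of I₁ ∖ I₂ and some free vertex of I₂ ∖ I₁ both lie in U_i; sliding one
-- to the other shrinks I₁ ∖ I₂. For the extra cluster U_i = ∅, so I₁ = I₂.
module Submission where

open import Defs hiding (sym)
open import Data.Nat using (ℕ; suc; _≤_; _<_)
open import Data.Nat.Properties using (<⇒≱; ≤-<-trans; ≤-reflexive)
open import Data.Nat.Induction using (<-wellFounded)
open import Induction.WellFounded using (Acc; acc)
open import Data.Bool.Properties using () renaming (_≟_ to _≟ᵇ_)
open import Data.Fin using (Fin; zero; suc)
open import Data.Fin.Properties using (_≟_)
open import Data.Fin.Subset
open import Data.Fin.Subset.Properties
open import Data.Vec using (_∷_; lookup; _[_]≔_; here; there)
open import Data.Vec.Properties
  using ( []≔-updates; []≔-minimal; []≔-idempotent; []≔-commutes; []≔-lookup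
        ; lookup∘update′; []=⇒lookup; lookup⇒[]=; []=-injective; ≡-dec)
open import Data.Product using (∃; _×_; _,_; proj₁; proj₂)
import Data.Product as Product
open import Data.Sum using (inj₁; inj₂)
open import Data.Empty using (⊥-elim)
open import Function using (_∘_)
open import Relation.Nullary using (¬_; yes; no)
open import Relation.Nullary.Decidable using (decidable-stable)
open import Relation.Binary.PropositionalEquality
open import Relation.Binary.Construct.Closure.ReflexiveTransitive using (Star; ε; _◅_; _◅◅_)

private
  variable
    n : ℕ
    p q S : Subset n
    x y z w : Fin n

x∈p─q⁻ : ∀ (p q : Subset n) → x ∈ p ─ q → x ∈ p × x ∉ q
x∈p─q⁻ (inside ∷ p) (outside ∷ q) here = here , λ ()
x∈p─q⁻ {x = zero} (outside ∷ p) (outside ∷ q) ()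
x∈p─q⁻ (_ ∷ p) (_ ∷ q) (there x∈p─q) = Product.map there (_∘ drop-there) (x∈p─q⁻ p q x∈p─q)

∈∧∉⇒≢ : x ∈ p → y ∉ p → x ≢ y
∈∧∉⇒≢ x∈p y∉p refl = y∉p x∈p

⊈⇒∃∈∉ : p ⊈ q → ∃ λ x → x ∈ p × x ∉ q
⊈⇒∃∈∉ {p = p} {q} p⊈q with nonempty? (p ─ q)
... | yes (x , x∈p─q) = x , x∈p─q⁻ p q x∈p─q
... | no p─q-empty = ⊥-elim (p⊈q λ {x} x∈p →
  decidable-stable (x ∈? q) (λ x∉q → p─q-empty (x , x∈p∧x∉q⇒x∈p─q x∈p x∉q)))

∣q∣≤∣p∣∧p≢q⇒∃∈∉ : ∣ q ∣ ≤ ∣ p ∣ → p ≢ q → ∃ λ x → x ∈ p × x ∉ q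
∣q∣≤∣p∣∧p≢q⇒∃∈∉ {q = q} {p} ∣q∣≤∣p∣ p≢q with p ⊆? q
... | no p⊈q = ⊈⇒∃∈∉ p⊈q
... | yes p⊆q = ⊥-elim (<⇒≱ (p⊂q⇒∣p∣<∣q∣ (p⊆q , ⊈⇒∃∈∉ (p≢q ∘ ⊆-antisym p⊆q))) ∣q∣≤∣p∣)

─-agree⇒∈ : p ─ S ≡ q ─ S → x ∈ p → x ∉ q → x ∈ S
─-agree⇒∈ {S = S} {q} {x} agree x∈p x∉q = decidable-stable (x ∈? S) λ x∉S →
  x∉q (p─q⊆p q S (subst (x ∈_) agree (x∈p∧x∉q⇒x∈p─q x∈p x∉S)))

unique∈⇒≡⁅⁆ : x ∈ p → (∀ {z} → z ∈ p → z ≡ x) → p ≡ ⁅ x ⁆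
unique∈⇒≡⁅⁆ {x = x} {p} x∈p unique = ⊆-antisym
  (λ z∈p → subst (_∈ ⁅ x ⁆) (sym (unique z∈p)) (x∈⁅x⁆ x))
  (λ z∈⁅x⁆ → subst (_∈ p) (sym (x∈⁅y⁆⇒x≡y x z∈⁅x⁆)) x∈p)

∈-[]≔⁻ : ∀ {b} → y ≢ x → y ∈ p [ x ]≔ b → y ∈ p
∈-[]≔⁻ {y = y} {p = p} {b} y≢x y∈ = lookup⇒[]= y p (trans (sym (lookup∘update′ y≢x p b)) ([]=⇒lookup y∈))

x∉p[x]≔outside : ∀ (p : Subset n) x → x ∉ p [ x ]≔ outside
x∉p[x]≔outside p x x∈ with []=-injective x∈ ([]≔-updates p x)
... | ()

x∈p⇒p[x]≔inside≡p : x ∈ p → p [ x ]≔ inside ≡ p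
x∈p⇒p[x]≔inside≡p {x = x} {p} x∈p = trans (cong (p [ x ]≔_) (sym ([]=⇒lookup x∈p))) ([]≔-lookup p x)

x∉p⇒p[x]≔outside≡p : x ∉ p → p [ x ]≔ outside ≡ p
x∉p⇒p[x]≔outside≡p {x = x} {p} x∉p with lookup p x in eq
... | inside = ⊥-elim (x∉p (lookup⇒[]= x p eq))
... | outside = trans (cong (p [ x ]≔_) (sym eq)) ([]≔-lookup p x)

x∉p⇒∣p[x]≔inside∣≡1+∣p∣ : ∀ (p : Subset n) → x ∉ p → ∣ p [ x ]≔ inside ∣ ≡ suc ∣ p ∣
x∉p⇒∣p[x]≔inside∣≡1+∣p∣ {x = zero}  (inside  ∷ p) x∉p = ⊥-elim (x∉p here)
x∉p⇒∣p[x]≔inside∣≡1+∣p∣ {x = zero}  (outside ∷ p) x∉p = refl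
x∉p⇒∣p[x]≔inside∣≡1+∣p∣ {x = suc x} (inside  ∷ p) x∉p = cong suc (x∉p⇒∣p[x]≔inside∣≡1+∣p∣ p (x∉p ∘ there))
x∉p⇒∣p[x]≔inside∣≡1+∣p∣ {x = suc x} (outside ∷ p) x∉p = x∉p⇒∣p[x]≔inside∣≡1+∣p∣ p (x∉p ∘ there)

slide : Subset n → Fin n → Fin n → Subset n
slide p x y = p [ x ]≔ outside [ y ]≔ inside

y∈slide : y ∈ slide p x y
y∈slide {y = y} {p} {x} = []≔-updates (p [ x ]≔ outside) y

x∉slide : x ≢ y → x ∉ slide p x y
x∉slide {x = x} {p = p} x≢y = x∉p[x]≔outside p x ∘ ∈-[]≔⁻ x≢y

∈-slide⁺ : z ≢ x → z ∈ p → z ∈ slide p x y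
∈-slide⁺ {z = z} {x} {p} {y} z≢x z∈p with z ≟ y
... | yes refl = y∈slide
... | no z≢y = []≔-minimal _ z y z≢y ([]≔-minimal p z x z≢x z∈p)

∈-slide⁻ : z ≢ y → z ∈ slide p x y → z ∈ p
∈-slide⁻ {z = z} {x = x} z≢y z∈ with z ≟ x
... | yes refl = ⊥-elim (x∉slide z≢y z∈)
... | no z≢x = ∈-[]≔⁻ z≢x (∈-[]≔⁻ z≢y z∈)

p─slide≡⁅x⁆ : x ∈ p → y ∉ p → p ─ slide p x y ≡ ⁅ x ⁆
p─slide≡⁅x⁆ {x = x} {p} x∈p y∉p =
  unique∈⇒≡⁅⁆ (x∈p∧x∉q⇒x∈p─q x∈p (x∉slide (∈∧∉⇒≢ x∈p y∉p))) λ {z} z∈ →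
    let z∈p , z∉slide = x∈p─q⁻ p _ z∈ in
    decidable-stable (z ≟ x) (λ z≢x → z∉slide (∈-slide⁺ z≢x z∈p))

slide─p≡⁅y⁆ : x ∈ p → y ∉ p → slide p x y ─ p ≡ ⁅ y ⁆
slide─p≡⁅y⁆ {p = p} {y = y} x∈p y∉p =
  unique∈⇒≡⁅⁆ (x∈p∧x∉q⇒x∈p─q y∈slide y∉p) λ {z} z∈ →
    let z∈slide , z∉p = x∈p─q⁻ _ p z∈ in
    decidable-stable (z ≟ y) (λ z≢y → z∉p (∈-slide⁻ z≢y z∈slide))

∣slide∣≡∣p∣ : x ∈ p → y ∉ p → ∣ slide p x y ∣ ≡ ∣ p ∣
∣slide∣≡∣p∣ {x = x} {p} {y} x∈p y∉p = begin
  ∣ slide p x y ∣                      ≡⟨ x∉p⇒∣p[x]≔inside∣≡1+∣p∣ _ (y∉p ∘ ∈-[]≔⁻ (∈∧∉⇒≢ x∈p y∉p ∘ sym)) ⟩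
  suc ∣ p [ x ]≔ outside ∣             ≡⟨ x∉p⇒∣p[x]≔inside∣≡1+∣p∣ _ (x∉p[x]≔outside p x) ⟨
  ∣ p [ x ]≔ outside [ x ]≔ inside ∣   ≡⟨ cong ∣_∣ ([]≔-idempotent p x) ⟩
  ∣ p [ x ]≔ inside ∣                  ≡⟨ cong ∣_∣ (x∈p⇒p[x]≔inside≡p x∈p) ⟩
  ∣ p ∣                                ∎
  where open ≡-Reasoning

slide─S≡p─S : x ∈ S → y ∈ S → slide p x y ─ S ≡ p ─ S
slide─S≡p─S {S = S} {p = p} x∈S y∈S = ⊆-antisym
  (λ z∈ → let z∈slide , z∉S = x∈p─q⁻ _ S z∈ in
    x∈p∧x∉q⇒x∈p─q (∈-slide⁻ (∈∧∉⇒≢ y∈S z∉S ∘ sym) z∈slide) z∉S)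
  (λ z∈ → let z∈p , z∉S = x∈p─q⁻ p S z∈ in
    x∈p∧x∉q⇒x∈p─q (∈-slide⁺ (∈∧∉⇒≢ x∈S z∉S ∘ sym) z∈p) z∉S)

∣slide─q∣<∣p─q∣ : x ∈ p → x ∉ q → y ∈ q → ∣ slide p x y ─ q ∣ < ∣ p ─ q ∣
∣slide─q∣<∣p─q∣ {x = x} {p} {q} {y} x∈p x∉q y∈q =
  ≤-<-trans (p⊆q⇒∣p∣≤∣q∣ slide─q⊆p─q-x) (x∈p⇒∣p-x∣<∣p∣ (x∈p∧x∉q⇒x∈p─q x∈p x∉q))
  where
  slide─q⊆p─q-x : slide p x y ─ q ⊆ p ─ q - x
  slide─q⊆p─q-x {z} z∈ =
    let z∈slide , z∉q = x∈p─q⁻ _ q z∈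
        z≢x : z ≢ x
        z≢x = λ { refl → x∉slide (∈∧∉⇒≢ y∈q x∉q ∘ sym) z∈slide }
    in x∈p∧x≢y⇒x∈p-y (x∈p∧x∉q⇒x∈p─q (∈-slide⁻ (∈∧∉⇒≢ y∈q z∉q ∘ sym) z∈slide) z∉q) z≢x

slide-slide-vacant : x ≢ w → w ∉ p → slide (slide p x w) w y ≡ slide p x y
slide-slide-vacant {x = x} {w} {p} {y} x≢w w∉p = cong (_[ y ]≔ inside) (begin
  p [ x ]≔ outside [ w ]≔ inside [ w ]≔ outside  ≡⟨ []≔-idempotent _ w ⟩
  p [ x ]≔ outside [ w ]≔ outside                ≡⟨ x∉p⇒p[x]≔outside≡p (w∉p ∘ ∈-[]≔⁻ (x≢w ∘ sym)) ⟩
  p [ x ]≔ outside                               ∎)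
  where open ≡-Reasoning

slide-slide-occupied : x ≢ w → x ≢ y → w ≢ y → w ∈ p → slide (slide p w y) x w ≡ slide p x y
slide-slide-occupied {x = x} {w} {y} {p} x≢w x≢y w≢y w∈p = begin
  p [ w ]≔ outside [ y ]≔ inside [ x ]≔ outside [ w ]≔ inside
    ≡⟨ cong (_[ w ]≔ inside) ([]≔-commutes _ y x (x≢y ∘ sym)) ⟩
  p [ w ]≔ outside [ x ]≔ outside [ y ]≔ inside [ w ]≔ inside
    ≡⟨ cong (λ q → q [ y ]≔ inside [ w ]≔ inside) ([]≔-commutes p w x (x≢w ∘ sym)) ⟩
  p [ x ]≔ outside [ w ]≔ outside [ y ]≔ inside [ w ]≔ inside
    ≡⟨ []≔-commutes _ y w (w≢y ∘ sym) ⟩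
  p [ x ]≔ outside [ w ]≔ outside [ w ]≔ inside [ y ]≔ inside
    ≡⟨ cong (_[ y ]≔ inside) ([]≔-idempotent _ w) ⟩
  p [ x ]≔ outside [ w ]≔ inside [ y ]≔ inside
    ≡⟨ cong (_[ y ]≔ inside) (x∈p⇒p[x]≔inside≡p ([]≔-minimal p w x (x≢w ∘ sym) w∈p)) ⟩
  p [ x ]≔ outside [ y ]≔ inside
    ∎
  where open ≡-Reasoning

module TokenSliding {n : ℕ} (G : Graph n) (VA : Subset n)
  (independent : ∀ x y → x ∉ VA → y ∉ VA → ¬ Adj G x y) where

  Hop : Fin n → Fin n → Set
  Hop x y = y ∉ VA × Dist≤2 G x y

  Slidable : Fin n → Fin n → Set
  Slidable x y = ∀ I → Typical G VA I → x ∈ I → y ∉ I → Reach₂ G I (slide I x y)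

  typical-slide : ∀ {I x y} → Typical G VA I → y ∉ VA → Typical G VA (slide I x y)
  typical-slide {I} {x} {y} (_ , I∩VA=∅) y∉VA =
    (λ u v u∈ v∈ → independent u v (avoids-VA u u∈) (avoids-VA v v∈)) , avoids-VA
    where
    avoids-VA : ∀ z → z ∈ slide I x y → z ∉ VA
    avoids-VA z z∈ with z ≟ y
    ... | yes refl = y∉VA
    ... | no z≢y = I∩VA=∅ z (∈-slide⁻ z≢y z∈)

  hop-slidable : ∀ {x y} → Hop x y → Slidable x y
  hop-slidable (y∉VA , dist) I typical x∈I y∉I =
    (proj₁ typical , proj₁ (typical-slide typical y∉VA) , _ , _ ,
     p─slide≡⁅x⁆ x∈I y∉I , slide─p≡⁅y⁆ x∈I y∉I , dist) ◅ ε

  -- An occupied intermediate vertex w has its token slid on to y first; x's token then takes its place.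
  slidable-trans : ∀ {x w y} → w ∉ VA → y ∉ VA → Slidable x w → Slidable w y → Slidable x y
  slidable-trans {x} {w} {y} w∉VA y∉VA x⇝w w⇝y I typical x∈I y∉I with w ∈? I | w ≟ y | w ≟ x
  ... | no w∉I | yes refl | _ = x⇝w I typical x∈I w∉I
  ... | no w∉I | no w≢y | _ =
    x⇝w I typical x∈I w∉I ◅◅
    subst (Reach₂ G _) (slide-slide-vacant (∈∧∉⇒≢ x∈I w∉I) w∉I)
      (w⇝y _ (typical-slide typical w∉VA) y∈slide (y∉I ∘ ∈-slide⁻ (w≢y ∘ sym)))
  ... | yes w∈I | _ | yes refl = w⇝y I typical w∈I y∉I
  ... | yes w∈I | _ | no w≢x =
    w⇝y I typical w∈I y∉I ◅◅
    subst (Reach₂ G _) (slide-slide-occupied (w≢x ∘ sym) (∈∧∉⇒≢ x∈I y∉I) w≢y w∈I)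
      (x⇝w _ (typical-slide typical y∉VA) (∈-slide⁺ (w≢x ∘ sym) x∈I) (x∉slide w≢y))
    where w≢y = ∈∧∉⇒≢ w∈I y∉I

  walk-slidable : ∀ {x y} → y ∉ VA → Star Hop x y → Slidable x y
  walk-slidable y∉VA ε _ _ x∈I x∉I = ⊥-elim (x∉I x∈I)
  walk-slidable y∉VA (hop ◅ walk) =
    slidable-trans (proj₁ hop) y∉VA (hop-slidable hop) (walk-slidable y∉VA walk)

  bipartite-walk⇒hops : ∀ {x y} → x ∉ VA → y ∉ VA → Star (BEdge G VA) x y → Star Hop x y
  bipartite-walk⇒hops x∉VA y∉VA ε = ε
  bipartite-walk⇒hops x∉VA y∉VA ((_ , inj₁ (x∈VA , _)) ◅ _) = ⊥-elim (x∉VA x∈VA)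
  bipartite-walk⇒hops x∉VA y∉VA ((_ , inj₂ (_ , y∈VA)) ◅ ε) = ⊥-elim (y∉VA y∈VA)
  bipartite-walk⇒hops x∉VA y∉VA ((_ , inj₂ (_ , a∈VA)) ◅ (_ , inj₂ (a∉VA , _)) ◅ _) = ⊥-elim (a∉VA a∈VA)
  bipartite-walk⇒hops x∉VA y∉VA ((xa , inj₂ _) ◅ (ab , inj₁ (_ , b∉VA)) ◅ walk) =
    (b∉VA , inj₂ (inj₂ (_ , xa , ab))) ◅ bipartite-walk⇒hops b∉VA y∉VA walk

  module _ (S : Subset n) (slidable : ∀ {x y} → x ∈ S → y ∈ S → Slidable x y) where

    reconfigure : ∀ I J → Typical G VA I → Typical G VA J →
      ∣ I ∣ ≡ ∣ J ∣ → I ─ S ≡ J ─ S → Reach₂ G I J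
    reconfigure I J typicalI typicalJ ∣I∣≡∣J∣ agree = go I typicalI ∣I∣≡∣J∣ agree (<-wellFounded _)
      where
      go : ∀ I → Typical G VA I → ∣ I ∣ ≡ ∣ J ∣ → I ─ S ≡ J ─ S → Acc _<_ ∣ I ─ J ∣ → Reach₂ G I J
      go I typical ∣I∣≡∣J∣ agree (acc smaller) with ≡-dec _≟ᵇ_ I J
      ... | yes refl = ε
      ... | no I≢J with ∣q∣≤∣p∣∧p≢q⇒∃∈∉ (≤-reflexive (sym ∣I∣≡∣J∣)) I≢J
                     | ∣q∣≤∣p∣∧p≢q⇒∃∈∉ (≤-reflexive ∣I∣≡∣J∣) (I≢J ∘ sym)
      ...   | x , x∈I , x∉J | y , y∈J , y∉I =
        slidable x∈S y∈S I typical x∈I y∉I ◅◅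
        go (slide I x y) (typical-slide typical (proj₂ typicalJ y y∈J))
           (trans (∣slide∣≡∣p∣ x∈I y∉I) ∣I∣≡∣J∣) (trans (slide─S≡p─S x∈S y∈S) agree)
           (smaller (∣slide─q∣<∣p─q∣ x∈I x∉J y∈J))
        where
        x∈S = ─-agree⇒∈ agree x∈I x∉J
        y∈S = ─-agree⇒∈ (sym agree) y∈J y∉I

lemma2 : {n : ℕ} (G : Graph n) (VA : Subset n) → IsSplit G VA →
    (Ui Vi : Subset n) → IsCluster G VA Ui Vi →
    (I₁ I₂ : Subset n) → Typical G VA I₁ → Typical G VA I₂ →
    ¬ (I₁ ≡ I₂) →
    ∣ I₁ ∣ ≡ ∣ I₂ ∣ →
    ∣ I₁ ∩ Ui ∣ ≡ ∣ I₂ ∩ Ui ∣ →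
    I₁ ─ Ui ≡ I₂ ─ Ui →
    Reach₂ G I₁ I₂
lemma2 G VA split Ui Vi (extra refl _ _) I₁ I₂ _ _ I₁≢I₂ _ _ agree =
  ⊥-elim (I₁≢I₂ (trans (sym (p─⊥≡p I₁)) (trans agree (p─⊥≡p I₂))))
lemma2 G VA split Ui Vi (component Ui∩VA=∅ _ _ _ _ connected) I₁ I₂ typical₁ typical₂ _ ∣I₁∣≡∣I₂∣ _ agree =
  reconfigure Ui slidable I₁ I₂ typical₁ typical₂ ∣I₁∣≡∣I₂∣ agree
  where
  open TokenSliding G VA (IsSplit.indep split)
  slidable : ∀ {x y} → x ∈ Ui → y ∈ Ui → Slidable x y
  slidable {x} {y} x∈Ui y∈Ui = walk-slidable y∉VA
    (bipartite-walk⇒hops (Ui∩VA=∅ x x∈Ui) y∉VA (connected x y (x∈p∪q⁺ (inj₁ x∈Ui)) (x∈p∪q⁺ (inj₁ y∈Ui))))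
    where y∉VA = Ui∩VA=∅ y y∈Ui
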